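{- Let $G$ be a directed acyclic graph and let $\langle s,t\rangle$ be a superbubble in $G$. Then there exists a child $c$ of $s$ (i.e. $(s,c)$ is an edge of $G$) such that $c$ has exactly one parent, namely $s$ (i.e. the in-degree of $c$ is $1$).
   Context: Let $G=(V,E)$ be a directed graph. A path is said to pass through a vertex $x$ if $x$ is an internal vertex of the path; every vertex is reachable from itself. For an ordered pair of distinct vertices $s,t$, $\langle s,t\rangle$ is a superbubble if: (reachability) $t$ is reachable from $s$; (matching) the set of vertices reachable from $s$ by a path not passing through $t$ equals the set of vertices from which $t$ is reachable by a path not passing through $s$; call this common set $U$ (it contains $s$ and $t$); (acyclicity) the subgraph of $G$ induced by $U$ is acyclic; (minimality) no vertex of $U$ other than $t$ forms, together with $s$ as first element, a pair satisfying the three preceding conditions. The vertices $s$, $t$ are the entrance and exit of the superbubble. -}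

module Defs where

open import Data.Nat using (ℕ)
open import Data.Fin using (Fin)
open import Data.Bool using (Bool; T)
open import Data.List using (List; []; _∷_)
open import Data.List.Membership.Propositional using (_∈_; _∉_)
open import Data.List.Relation.Unary.All using (All)
open import Data.Product using (Σ; _×_; ∃; ∃-syntax; _,_)
open import Relation.Nullary using (¬_)
open import Relation.Binary.PropositionalEquality using (_≡_; _≢_)

record Digraph : Set where
  field
    n   : ℕ
    adj : Fin n → Fin n → Bool

module _ (G : Digraph) where
  open Digraph G

  V : Set
  V = Fin n

  Edge : V → V → Set
  Edge u v = T (adj u v)

  -- Walks (paths in the sense of the paper: vertices may repeat).
  data Walk : V → V → Set where
    nil  : ∀ {u} → Walk u u
    cons : ∀ {u w v} → Edge u w → Walk w v → Walk u v

  verts : ∀ {u v} → Walk u v → List V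
  verts {u} nil = u ∷ []
  verts {u} (cons e p) = u ∷ verts p

  inner : ∀ {u v} → Walk u v → List V
  inner nil = []
  inner (cons e nil) = []
  inner (cons {w = w} e p@(cons _ _)) = w ∷ inner p

  NonEmpty : ∀ {u v} → Walk u v → Set
  NonEmpty nil = Data.Empty.⊥
    where import Data.Empty
  NonEmpty (cons _ _) = Data.Unit.⊤
    where import Data.Unit

  Acyclic : Set
  Acyclic = ∀ v (p : Walk v v) → NonEmpty p → Data.Empty.⊥
    where import Data.Empty

  InducedAcyclic : (V → Set) → Set
  InducedAcyclic U = ∀ v (p : Walk v v) → NonEmpty p → All U (verts p) → Data.Empty.⊥
    where import Data.Empty

  ReachAvoid : (s t v : V) → Set
  ReachAvoid s t v = Σ (Walk s v) λ p → t ∉ inner p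

  CoReachAvoid : (s t v : V) → Set
  CoReachAvoid s t v = Σ (Walk v t) λ p → s ∉ inner p

  -- reachability + matching + acyclicity for the distinct pair (s , t)
  BubbleConds : (s t : V) → Set
  BubbleConds s t =
    s ≢ t ×
    Walk s t ×
    (∀ v → (ReachAvoid s t v → CoReachAvoid s t v) × (CoReachAvoid s t v → ReachAvoid s t v)) ×
    InducedAcyclic (ReachAvoid s t)

  Superbubble : (s t : V) → Set
  Superbubble s t =
    BubbleConds s t ×
    (∀ t' → ReachAvoid s t t' → t' ≢ t → ¬ BubbleConds s t')

-- Pick a child c of the entrance s. If c has a parent p other than s, then c lies in
-- the bubble, hence so does p (through c it reaches the exit while avoiding s), so s
-- reaches p; the first vertex c' of such a walk is another child of s with a nonempty
-- walk c' ⇝ p → c. In a finite acyclic graph this strict order on vertices is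
-- well-founded, so descending along it must end at a child whose only parent is s.
module Submission where

open import Defs
open import Data.Bool.Properties using (T?)
open import Data.Empty using (⊥-elim)
open import Data.Fin.Induction using (spo-wellFounded)
open import Data.Fin.Properties using (any?; _≟_)
open import Data.List.Membership.Propositional using (_∉_)
open import Data.List.Relation.Unary.Any using (here; there)
open import Data.Product using (Σ; ∃; _×_; _,_; proj₁; proj₂)
open import Data.Sum using (_⊎_; inj₁; inj₂)
open import Data.Unit using (tt)
open import Induction.WellFounded using (WellFounded; WfRec; module All)
open import Level using (0ℓ)
open import Relation.Binary.Structures using (IsStrictPartialOrder)
open import Relation.Binary.PropositionalEquality
  using (_≡_; _≢_; refl; sym; resp₂)
open import Relation.Binary.PropositionalEquality.Properties using (isEquivalence)
open import Relation.Nullary using (¬_; yes; no)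
open import Relation.Nullary.Decidable using (_×-dec_; ¬?)

module _ (G : Digraph) where

  infixr 5 _++ʷ_
  infix 4 _⇝⁺_

  _++ʷ_ : ∀ {u v w} → Walk G u v → Walk G v w → Walk G u w
  nil      ++ʷ q = q
  cons e p ++ʷ q = cons e (p ++ʷ q)

  _⇝⁺_ : V G → V G → Set
  u ⇝⁺ v = ∃ λ w → Edge G u w × Walk G w v

  ⇝⁺-trans : ∀ {u v w} → u ⇝⁺ v → v ⇝⁺ w → u ⇝⁺ w
  ⇝⁺-trans (_ , e , p) (_ , e′ , q) = _ , e , p ++ʷ cons e′ q

  walk-edge⇒⇝⁺ : ∀ {u v w} → Walk G u v → Edge G v w → u ⇝⁺ w
  walk-edge⇒⇝⁺ nil        e = _ , e , nil
  walk-edge⇒⇝⁺ (cons e′ p) e = _ , e′ , p ++ʷ cons e nil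

  first-edge : ∀ {u v} → u ≢ v → Walk G u v → ∃ λ w → Edge G u w × Walk G w v
  first-edge u≢u nil        = ⊥-elim (u≢u refl)
  first-edge u≢v (cons e p) = _ , e , p

  ∉-inner-cons : ∀ {x u w v} (e : Edge G u w) (p : Walk G w v) →
                 x ≢ w → x ∉ inner G p → x ∉ inner G (cons e p)
  ∉-inner-cons e nil        x≢w x∉p ()
  ∉-inner-cons e (cons _ _) x≢w x∉p (here x≡w) = x≢w x≡w
  ∉-inner-cons e (cons _ _) x≢w x∉p (there x∈p) = x∉p x∈p

  SoleParent : V G → V G → Set
  SoleParent s c = ∀ p → Edge G p c → p ≡ s

  sole-parent-or-other : ∀ c s → SoleParent s c ⊎ ∃ λ p → Edge G p c × p ≢ s
  sole-parent-or-other c s with any? (λ p → T? (Digraph.adj G p c) ×-dec ¬? (p ≟ s))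
  ... | yes other = inj₂ other
  ... | no ¬other = inj₁ sole
    where
    sole : SoleParent s c
    sole p p→c with p ≟ s
    ... | yes p≡s = p≡s
    ... | no  p≢s = ⊥-elim (¬other (p , p→c , p≢s))

  module _ (acyclic : Acyclic G) where

    ⇝⁺-irrefl : ∀ {u v} → u ≡ v → ¬ u ⇝⁺ v
    ⇝⁺-irrefl refl (_ , e , p) = acyclic _ (cons e p) tt

    ⇝⁺-isStrictPartialOrder : IsStrictPartialOrder _≡_ _⇝⁺_
    ⇝⁺-isStrictPartialOrder = record
      { isEquivalence = isEquivalence
      ; irrefl        = ⇝⁺-irrefl
      ; trans         = ⇝⁺-trans
      ; <-resp-≈      = resp₂ _⇝⁺_
      }

    ⇝⁺-wellFounded : WellFounded _⇝⁺_
    ⇝⁺-wellFounded = spo-wellFounded ⇝⁺-isStrictPartialOrder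

    -- Only the matching condition is used: a child c of s is in the bubble via the
    -- one-edge walk, and prepending p → c keeps s off the inner vertices since s ≢ c.
    parent-of-child-reachable : ∀ {s t c p} → BubbleConds G s t →
                                Edge G s c → Edge G p c → Walk G s p
    parent-of-child-reachable {s} {t} {c} {p} (_ , _ , matching , _) s→c p→c =
      let (c⇝t , s∉c⇝t) = proj₁ (matching c) (cons s→c nil , λ ())
          p-coreaches : CoReachAvoid G s t p
          p-coreaches = cons p→c c⇝t , ∉-inner-cons p→c c⇝t s≢c s∉c⇝t
      in proj₁ (proj₂ (matching p) p-coreaches)
      where
      s≢c : s ≢ c
      s≢c refl = ⇝⁺-irrefl refl (_ , s→c , nil)

    earlier-child : ∀ {s t c p} → BubbleConds G s t → Edge G s c → Edge G p c → p ≢ s →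
                    ∃ λ c′ → Edge G s c′ × c′ ⇝⁺ c
    earlier-child bubble s→c p→c p≢s =
      let (c′ , s→c′ , c′⇝p) = first-edge (λ s≡p → p≢s (sym s≡p))
                                 (parent-of-child-reachable bubble s→c p→c)
      in c′ , s→c′ , walk-edge⇒⇝⁺ c′⇝p p→c

    entrance-has-sole-child : ∀ {s t} → BubbleConds G s t →
                              ∃ λ c → Edge G s c × SoleParent s c
    entrance-has-sole-child {s} bubble@(s≢t , s⇝t , _) =
      let (c₀ , s→c₀ , _) = first-edge s≢t s⇝t
      in All.wfRec ⇝⁺-wellFounded 0ℓ P descend c₀ s→c₀
      where
      P : V G → Set
      P c = Edge G s c → ∃ λ c′ → Edge G s c′ × SoleParent s c′

      descend : ∀ c → WfRec _⇝⁺_ P c → P c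
      descend c below s→c with sole-parent-or-other c s
      ... | inj₁ sole            = c , s→c , sole
      ... | inj₂ (p , p→c , p≢s) =
        let (c′ , s→c′ , c′⇝⁺c) = earlier-child bubble s→c p→c p≢s in below c′⇝⁺c s→c′

lemma3 : (G : Digraph) → Acyclic G → (s t : V G) → Superbubble G s t →
    Σ (V G) λ c → Edge G s c × (∀ p → Edge G p c → p ≡ s)
lemma3 G acyclic s t (bubble , _) = entrance-has-sole-child G acyclic bubble
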